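{- Let $G$ be a graph of girth at least five, let $r\ge 2$ be an integer and let $c$ be a positive integer. If $G$ admits a weak $r$-guidance system of maximum outdegree at most $c$, then $G$ also admits an $r$-guidance system of maximum outdegree at most $3c$.
   Context: All graphs are finite, simple and undirected. A partial orientation of $G$ is a directed graph $\vec{H}$ on $V(G)$ whose arcs $(u,v)$ satisfy $uv\in E(G)$ (edges may be undirected, directed one way, or both); it is an orientation if every edge is directed in at least one direction. $B_{\vec{H}}(v,a)$ is the set of vertices reachable from $v$ by directed paths in $\vec{H}$ of length at most $a$. A weak $r$-guidance system is a partial orientation $\vec{H}$ such that for any distinct $u,v$ at distance $\ell\le r$ there are non-negative integers $a,b$ with $a+b=\ell-1$ and an edge of $G$ between $B_{\vec{H}}(u,a)$ and $B_{\vec{H}}(v,b)$. An $r$-guidance system is an orientation $\vec{H}$ such that for any $u,v$ at distance $\ell\le r$ there are non-negative integers $a,b$ with $a+b=\ell$ and $B_{\vec{H}}(u,a)\cap B_{\vec{H}}(v,b)\ne\emptyset$. -}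

module Defs where

open import Data.Nat using (ℕ; zero; suc; _+_; _≤_)
open import Data.Bool using (Bool; true; false)
open import Data.Fin using (Fin)
open import Data.Vec using (count; tabulate)
open import Data.Product using (Σ; ∃; _×_; _,_)
open import Data.Sum using (_⊎_)
open import Data.Empty using (⊥)
open import Relation.Nullary using (¬_)
open import Relation.Binary.PropositionalEquality using (_≡_; _≢_)
open import Relation.Nullary.Decidable using (Dec)
open import Data.Bool.Properties using (_≟_)

record Graph (n : ℕ) : Set where
  field
    adj     : Fin n → Fin n → Bool
    symm    : ∀ u v → adj u v ≡ adj v u
    irrefl  : ∀ v → adj v v ≡ false
open Graph public

data Walk {n : ℕ} (G : Graph n) : Fin n → Fin n → ℕ → Set where
  here : ∀ {v} → Walk G v v 0
  step : ∀ {u w v ℓ} → adj G u w ≡ true → Walk G w v ℓ → Walk G u v (suc ℓ)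

Dist : {n : ℕ} → Graph n → Fin n → Fin n → ℕ → Set
Dist G u v ℓ = Walk G u v ℓ × (∀ m → Walk G u v m → ℓ ≤ m)

-- girth at least five: no cycles of length 3 or 4
-- (vertices of a triangle are automatically distinct by irreflexivity)
GirthAtLeast5 : {n : ℕ} → Graph n → Set
GirthAtLeast5 {n} G =
  (∀ (a b c : Fin n) → ¬ (adj G a b ≡ true × adj G b c ≡ true × adj G c a ≡ true))
  × (∀ (a b c d : Fin n) → a ≢ c → b ≢ d →
       ¬ (adj G a b ≡ true × adj G b c ≡ true × adj G c d ≡ true × adj G d a ≡ true))

-- A partial orientation of G: a digraph on V(G) whose arcs are edges of G
-- (an edge may carry no arc, one arc, or both arcs).
record PartialOrientation {n : ℕ} (G : Graph n) : Set where
  field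
    arc      : Fin n → Fin n → Bool
    arc⊆edge : ∀ u v → arc u v ≡ true → adj G u v ≡ true
open PartialOrientation public

IsOrientation : {n : ℕ} {G : Graph n} → PartialOrientation G → Set
IsOrientation {n} {G} H =
  ∀ (u v : Fin n) → adj G u v ≡ true → arc H u v ≡ true ⊎ arc H v u ≡ true

outdeg : {n : ℕ} {G : Graph n} → PartialOrientation G → Fin n → ℕ
outdeg H v = count (λ u → arc H v u ≟ true) (tabulate (λ u → u))

MaxOutdegAtMost : {n : ℕ} {G : Graph n} → PartialOrientation G → ℕ → Set
MaxOutdegAtMost {n} H c = ∀ (v : Fin n) → outdeg H v ≤ c

data DWalk {n : ℕ} {G : Graph n} (H : PartialOrientation G) : Fin n → Fin n → ℕ → Set where
  here : ∀ {v} → DWalk H v v 0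
  step : ∀ {u w v k} → arc H u w ≡ true → DWalk H w v k → DWalk H u v (suc k)

-- w ∈ B_H(v,a): w reachable from v by a directed walk of length ≤ a
-- (equivalently a directed path of length ≤ a).
InBall : {n : ℕ} {G : Graph n} → PartialOrientation G → Fin n → ℕ → Fin n → Set
InBall H v a w = Σ ℕ (λ k → k ≤ a × DWalk H v w k)

WeakGuidance : {n : ℕ} (G : Graph n) → ℕ → PartialOrientation G → Set
WeakGuidance {n} G r H =
  ∀ (u v : Fin n) (ℓ : ℕ) → u ≢ v → Dist G u v ℓ → ℓ ≤ r →
    Σ ℕ λ a → Σ ℕ λ b → suc (a + b) ≡ ℓ ×
      Σ (Fin n) λ x → Σ (Fin n) λ y →
        InBall H u a x × InBall H v b y × adj G x y ≡ true

Guidance : {n : ℕ} (G : Graph n) → ℕ → PartialOrientation G → Set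
Guidance {n} G r H =
  IsOrientation H ×
  (∀ (u v : Fin n) (ℓ : ℕ) → Dist G u v ℓ → ℓ ≤ r →
    Σ ℕ λ a → Σ ℕ λ b → a + b ≡ ℓ ×
      Σ (Fin n) λ w → InBall H u a w × InBall H v b w)

{-# OPTIONS --safe #-}
-- For every edge wu of G that the weak guidance system H does not orient towards w,
-- add the arc w → u. Two such neighbours u, v of w would be at distance 2, and the edge
-- promised by weak guidance between B(u,a) and B(v,b) with a + b = 1 would close a
-- triangle or a 4-cycle; so each vertex gains at most one out-arc, and the outdegree
-- becomes at most c + 1 ≤ 3c. The result orients every edge, so the edge xy joining
-- B(u,a) and B(v,b) is now an arc in one direction, and following it enlarges one of
-- the two balls by one step into a common vertex.
module Submission where

open import Defs
open import Data.Nat using (ℕ; zero; suc; _+_; _≤_; _*_; z≤n; s≤s)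
open import Data.Nat.Properties
  using (≤-refl; ≤-trans; ≤-reflexive; +-suc; +-monoˡ-≤; +-monoʳ-≤; m≤m+n; m≤n⇒m≤o+n; n≤0⇒n≡0)
open import Data.Bool using (Bool; true; false; _∨_; _∧_; not)
open import Data.Bool.Properties using (_≟_)
open import Data.Fin using (Fin)
import Data.Fin.Properties as Fin
open import Data.Vec using (Vec; []; _∷_; count; tabulate)
open import Data.Product using (Σ; _×_; _,_; proj₁; proj₂)
open import Data.Sum using (_⊎_; inj₁; inj₂)
open import Data.Empty using (⊥-elim)
open import Relation.Nullary using (¬_; yes; no)
open import Relation.Binary.PropositionalEquality using (_≡_; _≢_; refl; sym; trans; cong)

countTrue : ∀ {a} {A : Set a} {m} → (A → Bool) → Vec A m → ℕ
countTrue p = count (λ x → p x ≟ true)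

countTrue-∨ : ∀ {a} {A : Set a} {m} (p q : A → Bool) (xs : Vec A m) →
  countTrue (λ x → p x ∨ q x) xs ≤ countTrue p xs + countTrue q xs
countTrue-∨ p q [] = z≤n
countTrue-∨ p q (x ∷ xs) with p x | q x | countTrue-∨ p q xs
... | true  | true  | ih = s≤s (≤-trans ih (+-monoʳ-≤ _ (m≤n⇒m≤o+n 1 ≤-refl)))
... | true  | false | ih = s≤s ih
... | false | true  | ih = ≤-trans (s≤s ih) (≤-reflexive (sym (+-suc _ _)))
... | false | false | ih = ih

countTrue-tabulate-none : ∀ {a} {A : Set a} {m} (p : A → Bool) (f : Fin m → A) →
  (∀ i → p (f i) ≡ false) → countTrue p (tabulate f) ≡ 0
countTrue-tabulate-none {m = zero}  p f none = refl
countTrue-tabulate-none {m = suc m} p f none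
  rewrite none Fin.zero = countTrue-tabulate-none p (λ i → f (Fin.suc i)) (λ i → none (Fin.suc i))

countTrue-tabulate-atMostOne : ∀ {a} {A : Set a} {m} (p : A → Bool) (f : Fin m → A) →
  (∀ i j → p (f i) ≡ true → p (f j) ≡ true → i ≡ j) → countTrue p (tabulate f) ≤ 1
countTrue-tabulate-atMostOne {m = zero}  p f unique = z≤n
countTrue-tabulate-atMostOne {m = suc m} p f unique with p (f Fin.zero) in p₀
... | true  = ≤-reflexive (cong suc (countTrue-tabulate-none p (λ i → f (Fin.suc i)) rest-false))
  where
  rest-false : ∀ i → p (f (Fin.suc i)) ≡ false
  rest-false i with p (f (Fin.suc i)) in pᵢ
  ... | false = refl
  ... | true with () ← unique Fin.zero (Fin.suc i) p₀ pᵢ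
... | false = countTrue-tabulate-atMostOne p (λ i → f (Fin.suc i))
                (λ i j pᵢ pⱼ → Fin.suc-injective (unique (Fin.suc i) (Fin.suc j) pᵢ pⱼ))

adj-sym : ∀ {n} (G : Graph n) {u v} → adj G u v ≡ true → adj G v u ≡ true
adj-sym G {u} {v} uv = trans (sym (symm G u v)) uv

module _ {n : ℕ} {G : Graph n} where

  walk₀⇒≡ : ∀ {u v} → Walk G u v 0 → u ≡ v
  walk₀⇒≡ here = refl

  walk₁⇒adj : ∀ {u v} → Walk G u v 1 → adj G u v ≡ true
  walk₁⇒adj (step uv here) = uv

  TriangleFree : Set
  TriangleFree = ∀ a b c → ¬ (adj G a b ≡ true × adj G b c ≡ true × adj G c a ≡ true)

  commonNeighbour⇒dist₂ : TriangleFree → ∀ {u w v} → u ≢ v →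
    adj G u w ≡ true → adj G w v ≡ true → Dist G u v 2
  commonNeighbour⇒dist₂ noTriangle {u} {w} {v} u≢v uw wv = step uw (step wv here) , minimal
    where
    minimal : ∀ m → Walk G u v m → 2 ≤ m
    minimal zero          p = ⊥-elim (u≢v (walk₀⇒≡ p))
    minimal (suc zero)    p = ⊥-elim (noTriangle u w v (uw , wv , adj-sym G (walk₁⇒adj p)))
    minimal (suc (suc m)) p = s≤s (s≤s z≤n)

  weakGuidance-mono : ∀ {r s} {H : PartialOrientation G} → r ≤ s → WeakGuidance G s H → WeakGuidance G r H
  weakGuidance-mono r≤s wg u v ℓ u≢v d ℓ≤r = wg u v ℓ u≢v d (≤-trans ℓ≤r r≤s)

  module _ {H : PartialOrientation G} where

    inBall₀⇒≡ : ∀ {u x} → InBall H u 0 x → u ≡ x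
    inBall₀⇒≡ (zero , z≤n , here) = refl

    inBall₁⇒≡⊎arc : ∀ {u x} → InBall H u 1 x → u ≡ x ⊎ arc H u x ≡ true
    inBall₁⇒≡⊎arc (zero , _ , here)             = inj₁ refl
    inBall₁⇒≡⊎arc (suc zero , _ , step ux here) = inj₂ ux
    inBall₁⇒≡⊎arc (suc (suc k) , s≤s () , _)

    dWalk-snoc : ∀ {u v w k} → DWalk H u v k → arc H v w ≡ true → DWalk H u w (suc k)
    dWalk-snoc here       vw = step vw here
    dWalk-snoc (step e p) vw = step e (dWalk-snoc p vw)

    inBall-snoc : ∀ {u v w a} → InBall H u a v → arc H v w ≡ true → InBall H u (suc a) w
    inBall-snoc (k , k≤a , p) vw = suc k , s≤s k≤a , dWalk-snoc p vw

  _⊆_ : PartialOrientation G → PartialOrientation G → Set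
  H ⊆ H′ = ∀ u v → arc H u v ≡ true → arc H′ u v ≡ true

  module _ {H H′ : PartialOrientation G} (H⊆H′ : H ⊆ H′) where

    dWalk-mono : ∀ {u v k} → DWalk H u v k → DWalk H′ u v k
    dWalk-mono here                = here
    dWalk-mono (step {u} {w} uw p) = step (H⊆H′ u w uw) (dWalk-mono p)

    inBall-mono : ∀ {u a x} → InBall H u a x → InBall H′ u a x
    inBall-mono (k , k≤a , p) = k , k≤a , dWalk-mono p

    weakGuidance⇒guidance : ∀ {r} → IsOrientation H′ → WeakGuidance G r H → Guidance G r H′
    weakGuidance⇒guidance {r} orient wg = orient , meet
      where
      meet : ∀ u v ℓ → Dist G u v ℓ → ℓ ≤ r →
        Σ ℕ λ a → Σ ℕ λ b → a + b ≡ ℓ × Σ (Fin n) λ w → InBall H′ u a w × InBall H′ v b w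
      meet u v ℓ d ℓ≤r with u Fin.≟ v
      ... | yes refl = 0 , 0 , sym (n≤0⇒n≡0 (proj₂ d 0 here)) , u , (0 , z≤n , here) , (0 , z≤n , here)
      ... | no u≢v with wg u v ℓ u≢v d ℓ≤r
      ... | a , b , a+b+1≡ℓ , x , y , x∈B , y∈B , xy with orient x y xy
      ...   | inj₁ x→y = suc a , b , a+b+1≡ℓ , y , inBall-snoc (inBall-mono x∈B) x→y , inBall-mono y∈B
      ...   | inj₂ y→x = a , suc b , trans (+-suc a b) a+b+1≡ℓ , x , inBall-mono x∈B , inBall-snoc (inBall-mono y∈B) y→x

module Completion {n : ℕ} {G : Graph n} (H : PartialOrientation G) where

  added : Fin n → Fin n → Bool
  added w u = adj G w u ∧ not (arc H u w)

  completion : PartialOrientation G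
  completion = record
    { arc      = λ u v → arc H u v ∨ added u v
    ; arc⊆edge = arc⊆edge′
    }
    where
    arc⊆edge′ : ∀ u v → (arc H u v ∨ added u v) ≡ true → adj G u v ≡ true
    arc⊆edge′ u v e with arc H u v in uv
    ... | true = arc⊆edge H u v uv
    ... | false with adj G u v
    ...   | true  = refl
    ...   | false = e

  ⊆-completion : H ⊆ completion
  ⊆-completion u v uv rewrite uv = refl

  completion-isOrientation : IsOrientation completion
  completion-isOrientation u v uv with arc H v u in vu
  ... | true  = inj₂ refl
  ... | false rewrite uv with arc H u v
  ...   | true  = inj₁ refl
  ...   | false = inj₁ refl

  added⇒adj : ∀ {w u} → added w u ≡ true → adj G w u ≡ true
  added⇒adj {w} {u} e with adj G w u
  ... | true = refl

  added⇒¬arc : ∀ {w u} → added w u ≡ true → arc H u w ≡ false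
  added⇒¬arc {w} {u} e with adj G w u | arc H u w
  ... | true | false = refl

  outdeg-completion : (∀ w u v → added w u ≡ true → added w v ≡ true → u ≡ v) →
    ∀ w → outdeg completion w ≤ outdeg H w + 1
  outdeg-completion unique w =
    ≤-trans (countTrue-∨ (arc H w) (added w) (tabulate (λ u → u)))
            (+-monoʳ-≤ (outdeg H w) (countTrue-tabulate-atMostOne (added w) (λ u → u) (unique w)))

  module _ (g5 : GirthAtLeast5 G) (wg : WeakGuidance G 2 H) where

    -- y ∈ B(v,1) adjacent to u is either v itself (a triangle uwv) or an out-neighbour
    -- of v other than w (a 4-cycle uwvy).
    ¬adj-ball₁ : ∀ {u w v y} → u ≢ v → adj G u w ≡ true → adj G w v ≡ true → arc H v w ≡ false →
      InBall H v 1 y → ¬ adj G u y ≡ true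
    ¬adj-ball₁ {u} {w} {v} {y} u≢v uw wv ¬vw y∈B uy with inBall₁⇒≡⊎arc y∈B
    ... | inj₁ refl = proj₁ g5 u w v (uw , wv , adj-sym G uy)
    ... | inj₂ vy with y Fin.≟ w
    ...   | yes refl with () ← trans (sym vy) ¬vw
    ...   | no y≢w = proj₂ g5 u w v y u≢v (λ w≡y → y≢w (sym w≡y)) (uw , wv , arc⊆edge H v y vy , adj-sym G uy)

    inNeighbour-unique : ∀ {w u v} → adj G u w ≡ true → adj G w v ≡ true →
      arc H u w ≡ false → arc H v w ≡ false → u ≡ v
    inNeighbour-unique {w} {u} {v} uw wv ¬uw ¬vw with u Fin.≟ v
    ... | yes u≡v = u≡v
    ... | no u≢v with wg u v 2 u≢v (commonNeighbour⇒dist₂ (proj₁ g5) u≢v uw wv) ≤-refl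
    ... | zero , suc zero , refl , x , y , x∈B , y∈B , xy with refl ← inBall₀⇒≡ x∈B =
      ⊥-elim (¬adj-ball₁ u≢v uw wv ¬vw y∈B xy)
    ... | suc zero , zero , refl , x , y , x∈B , y∈B , xy with refl ← inBall₀⇒≡ y∈B =
      ⊥-elim (¬adj-ball₁ (λ v≡u → u≢v (sym v≡u)) (adj-sym G wv) (adj-sym G uw) ¬uw x∈B (adj-sym G xy))
    ... | zero , zero , () , _
    ... | zero , suc (suc b) , () , _
    ... | suc zero , suc b , () , _
    ... | suc (suc a) , b , () , _

    added-unique : ∀ w u v → added w u ≡ true → added w v ≡ true → u ≡ v
    added-unique w u v wu wv =
      inNeighbour-unique (adj-sym G (added⇒adj wu)) (added⇒adj wv) (added⇒¬arc wu) (added⇒¬arc wv)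

c+1≤3c : ∀ {c} → 1 ≤ c → c + 1 ≤ 3 * c
c+1≤3c {c} 1≤c = +-monoʳ-≤ c (≤-trans 1≤c (m≤m+n c _))

corollary30 : (n : ℕ) (G : Graph n) → GirthAtLeast5 G →
    (r : ℕ) → 2 ≤ r → (c : ℕ) → 1 ≤ c →
    Σ (PartialOrientation G) (λ H → WeakGuidance G r H × MaxOutdegAtMost H c) →
    Σ (PartialOrientation G) (λ H → Guidance G r H × MaxOutdegAtMost H (3 * c))
corollary30 n G g5 r 2≤r c 1≤c (H , wg , outdeg≤c) =
  completion ,
  weakGuidance⇒guidance ⊆-completion completion-isOrientation wg ,
  λ w → ≤-trans (outdeg-completion (added-unique g5 (weakGuidance-mono 2≤r wg)) w)
                (≤-trans (+-monoˡ-≤ 1 (outdeg≤c w)) (c+1≤3c 1≤c))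
  where open Completion H
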